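{- For positive integers $h$ and $r$ with $r \geq 3$, there are at least $2^{r^{(r-1)(h-1)-2r}}$ distinct colorings that can be obtained from $c_{r,h}$ by replacing each occurrence of the color $0$ with $-$ or $+$.
   Context: A composition of $m$ into $k$ parts is a tuple $(p_1,\dots,p_k)$ of positive integers with sum $m$. The reduction step maps $(p_1,\dots,p_k)$ to $(p_1,\dots,p_k-1)$ if $p_k>1$ and to $(p_1,\dots,p_{k-1})$ if $p_k=1$. The reduction of a composition $\sigma$ is the (unique, if it exists) composition of the form $(1,\dots,1,2)$ or $(p,1)$ with $p>1$ obtained from $\sigma$ by a sequence of reduction steps; it exists iff $\sigma\ne(1,\dots,1)$ and $\sigma\ne(r)$. Signs of compositions of $r\ge3$: for $r=3$, $(1,2)$ is negative and $(2,1)$ positive. For $r>3$, $\sigma$ is negative if its reduction is negative, or $\sigma=(1,\dots,1,2)$ with $r$ odd, or $\sigma=(r-1,1)$ with $r$ even; $\sigma$ is positive if its reduction is positive, or $\sigma=(1,\dots,1,2)$ with $r$ even, or $\sigma=(r-1,1)$ with $r$ odd. The 3-coloring $c_{r,h}$ of the $r$-subsets of $[r^h]$ with colors $\{ -,0,+\}$: for $h=1$, the unique edge $[r]$ gets $0$. For $h\ge2$, let $n=r^h$, $m=r^{h-1}$, $V_i=\{(i-1)m+1,\dots,im\}$ for $i\in[r]$. For an $r$-set $e$, let $e_1,\dots,e_k$ be the nonempty sets among $e\cap V_1,\dots,e\cap V_r$ in order, $p_i=|e_i|$, $\sigma=(p_1,\dots,p_k)$. If $\sigma$ is negative, $c_{r,h}(e)=-$;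 if positive, $+$. If $\sigma=(r)$, i.e., $e=\{v_1,\dots,v_r\}\subseteq V_i$, then $c_{r,h}(e)=c_{r,h-1}(\{v_1-(i-1)m,\dots,v_r-(i-1)m\})$. If $\sigma=(1,\dots,1)$, then $v_i\in V_i$ for all $i$; put $v_i'=v_i-(i-1)m$ and set $c_{r,h}(e)=-$, $0$, or $+$ according as $\sum_{i\text{ even}}v_i'$ is $<$, $=$, or $>$ $\sum_{i\text{ odd}}v_i'$ (sums over $i\in[r]$). -}

module Defs where

open import Data.Bool using (Bool; true; false; if_then_else_; _∧_)
open import Data.Nat using (ℕ; zero; suc; _+_; _*_; _∸_; _^_; _≤_; _<ᵇ_; _≡ᵇ_; _/_)
open import Data.Nat.Properties using ()
open import Data.Integer as ℤ using (ℤ; +_; -[1+_])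
open import Data.List using (List; []; _∷_; reverse; map; length)
open import Data.Nat.ListAction using (sum)
open import Data.Maybe using (Maybe; just; nothing)
open import Data.Product using (Σ; _×_; _,_; proj₁; proj₂; ∃-syntax)
open import Data.Sum using (_⊎_)
open import Data.Vec using (Vec; []; _∷_)
open import Data.Fin.Subset using (Subset; ∣_∣)
open import Relation.Binary.PropositionalEquality using (_≡_; _≢_)
open import Relation.Nullary using (¬_)

data Color : Set where
  neg zer pos : Color

-- Compositions are lists of positive naturals.

-- one reduction step, acting on the reversed composition
stepRev : List ℕ → List ℕ
stepRev []                  = []
stepRev (zero ∷ ps)         = ps      -- degenerate (not a composition)
stepRev (suc zero ∷ ps)     = ps
stepRev (suc (suc p) ∷ ps)  = suc p ∷ ps

-- reduction step: (p1,..,pk) ↦ (p1,..,pk - 1) if pk > 1, (p1,..,p(k-1)) if pk = 1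
reductionStep : List ℕ → List ℕ
reductionStep σ = reverse (stepRev (reverse σ))

data Shape : Set where
  onesTwo : Shape   -- (1,...,1,2) with at least one 1
  pOne    : Shape   -- (p,1) with p > 1
  other   : Shape

isOnesThenTwo : List ℕ → Bool
isOnesThenTwo (2 ∷ [])  = true
isOnesThenTwo (1 ∷ ps)  = isOnesThenTwo ps
isOnesThenTwo _         = false

shape : List ℕ → Shape
shape (1 ∷ ps) = if isOnesThenTwo ps then onesTwo else other
shape (suc (suc p) ∷ 1 ∷ []) = pOne
shape _ = other

reduceFuel : ℕ → List ℕ → Maybe (Σ (List ℕ) (λ _ → Shape))
reduceFuel zero σ = nothing
reduceFuel (suc f) σ with shape σ
... | onesTwo = just (σ , onesTwo)
... | pOne    = just (σ , pOne)
... | other   = reduceFuel f (reductionStep σ)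

-- the reduction of σ (each step lowers the sum by 1, so sum σ + 1 steps suffice)
reduction : List ℕ → Maybe (Σ (List ℕ) (λ _ → Shape))
reduction σ = reduceFuel (suc (sum σ)) σ

even? : ℕ → Bool
even? zero = true
even? (suc zero) = false
even? (suc (suc n)) = even? n

-- sign of a composition: that of its reduction ρ (of sum s), where
-- (1,...,1,2) is negative iff s is odd, (p,1) is negative iff s is even.
-- (For s = 3 this is: (1,2) negative, (2,1) positive.)
-- Returns zer when σ has no sign (no reduction).
compSign : List ℕ → Color
compSign σ with reduction σ
... | nothing             = zer
... | just (ρ , onesTwo)  = if even? (sum ρ) then pos else neg
... | just (ρ , pOne)     = if even? (sum ρ) then neg else pos
... | just (ρ , other)    = zer

-- 0-based index of the block of size m containing v ∈ [1, ...]
blockOf : ℕ → ℕ → ℕ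
blockOf m zero = 0
blockOf zero v = 0
blockOf (suc m) (suc v) = v / suc m

-- group the (sorted) elements by block: list of (block index, members)
insertGrp : ℕ → ℕ → List (ℕ × List ℕ) → List (ℕ × List ℕ)
insertGrp b v []                 = (b , v ∷ []) ∷ []
insertGrp b v ((b' , vs) ∷ gs)   =
  if b ≡ᵇ b' then (b' , v ∷ vs) ∷ gs else (b , v ∷ []) ∷ (b' , vs) ∷ gs

groups : ℕ → List ℕ → List (ℕ × List ℕ)
groups m []       = []
groups m (v ∷ vs) = insertGrp (blockOf m v) v (groups m vs)

-- sums of v'_i = v - (i-1) m over even i (i.e. odd 0-based block index b)
-- and over odd i (even b)
sumEvenI sumOddI : ℕ → List ℕ → ℕ
sumEvenI m []       = 0
sumEvenI m (v ∷ vs) =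
  (if even? (blockOf m v) then 0 else v ∸ blockOf m v * m) + sumEvenI m vs
sumOddI m []       = 0
sumOddI m (v ∷ vs) =
  (if even? (blockOf m v) then v ∸ blockOf m v * m else 0) + sumOddI m vs

compare3 : ℕ → ℕ → Color
compare3 a b = if a <ᵇ b then neg else (if a ≡ᵇ b then zer else pos)

allSingletons : List (ℕ × List ℕ) → Bool
allSingletons []              = true
allSingletons ((_ , vs) ∷ gs) = (length vs ≡ᵇ 1) ∧ allSingletons gs

-- case analysis at level h ≥ 2 with block size m = r^(h-1), given the
-- coloring `rec` = c_{r,h-1} and the blocks met by the r-set xs
colorStep : (List ℕ → Color) → ℕ → List ℕ → List (ℕ × List ℕ) → Color
colorStep rec m xs ((b , _) ∷ []) = rec (map (λ v → v ∸ b * m) xs)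
colorStep rec m xs gs =
  if allSingletons gs
    then compare3 (sumEvenI m xs) (sumOddI m xs)
    else compSign (map (λ g → length (proj₂ g)) gs)

-- colorL r h xs = c_{r,h}({xs}) for xs the increasing list of the elements
-- (1-based) of an r-subset of [r^h]; h ≥ 1 (the value at h = 0 is irrelevant).
colorL : ℕ → ℕ → List ℕ → Color
colorL r zero xs = zer
colorL r (suc zero) xs = zer
colorL r (suc (suc h)) xs =
  colorStep (colorL r (suc h)) (r ^ suc h) xs (groups (r ^ suc h) xs)

-- r-subsets of [n] (element i+1 of [n] ↔ position i of the subset)

Edge : ℕ → ℕ → Set
Edge r n = Σ (Subset n) (λ s → ∣ s ∣ ≡ r)

elems : ∀ {n} → Subset n → List ℕ
elems []            = []
elems (true ∷ bs)   = 1 ∷ map suc (elems bs)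
elems (false ∷ bs)  = map suc (elems bs)

c : (r h : ℕ) → Edge r (r ^ h) → Color
c r h e = colorL r h (elems (proj₁ e))

ObtainedFrom : ∀ {r n} → (Edge r n → Color) → (Edge r n → Color) → Set
ObtainedFrom {r} {n} col f = (e : Edge r n) →
  (col e ≡ zer → (f e ≡ neg ⊎ f e ≡ pos)) × (col e ≢ zer → f e ≡ col e)

Distinct : ∀ {r n} → (Edge r n → Color) → (Edge r n → Color) → Set
Distinct {r} {n} f g = ¬ ((e : Edge r n) → f e ≡ g e)

-- N ≥ 2^(r^e) for an integer exponent e (as real numbers):
--   e ≥ 0 :  2^(r^e) ≤ N
--   e = -k < 0 :  N ≥ 2^(r^(-k))  ⟺  N^(r^k) ≥ 2
AtLeast2PowPow : ℕ → ℕ → ℤ → Set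
AtLeast2PowPow N r (+ e)     = 2 ^ (r ^ e) ≤ N
AtLeast2PowPow N r -[1+ k ]  = 2 ≤ N ^ (r ^ suc k)

module Submission where

-- * A counting principle (`fillings`): if every i < K is the code of some
--   edge of colour 0, then for N < 2^K we may fill the zero of an edge e by
--   the (code e)-th binary digit of N.  This gives 2^K colourings obtained
--   from the original one, pairwise distinct because two distinct N < 2^K
--   differ in some digit i < K, i.e. at the zero edge with code i.
--
-- * Many zero edges (`zeroEdges`): for h ≥ 2 a transversal edge, meeting each
--   of the r top-level blocks V_1,…,V_r (of size m = r^(h-1)) once, has
--   colour 0 exactly when the offsets in the odd-numbered and even-numbered
--   blocks have equal sums.  Writing t = r^(h-2), any r - 1 digits below t,
--   raised by t in alternate blocks, fill blocks V_2,…,V_r, and the offset in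
--   V_1 can always be chosen to balance the sums.  The digits are read back
--   from the edge, so these are t^(r-1) zero edges with distinct codes.
--   For h = 1 the single edge has colour 0.
--
-- Finally (r - 1)(h - 1) - 2r ≤ (h - 2)(r - 1) turns 2^(t^(r-1)) into the
-- bound of the theorem.

open import Defs
open import Data.Bool using (Bool; true; false; if_then_else_; not)
open import Data.Bool.Properties using (not-involutive) renaming (_≟_ to _≟ᵇ_)
open import Data.Empty using (⊥-elim)
open import Data.Fin as Fin using (Fin; toℕ; fromℕ<)
open import Data.Fin.Properties using (toℕ-fromℕ<)
open import Data.Fin.Subset as Subset using (Subset; ∣_∣; ⁅_⁆; ⊤)
open import Data.Fin.Subset.Properties using (∣⁅x⁆∣≡1; ∣⊤∣≡n)
open import Data.Integer using (+_; -[1+_]; -_; _-_)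
open import Data.Integer.Properties using (m-n≡m⊖n; ⊖-≥; ⊖-<; +-injective)
open import Data.List using (List; []; _∷_; map; length; drop; applyUpTo)
  renaming (_++_ to _++ˡ_)
open import Data.List.Properties using (length-applyUpTo; map-id; map-++; map-∘)
open import Data.List.Relation.Unary.All using (All)
import Data.List.Relation.Unary.All.Properties as AllP
open import Data.List.Relation.Unary.AllPairs using (AllPairs)
import Data.List.Relation.Unary.AllPairs.Properties as AllPairsP
open import Data.Nat
open import Data.Nat.DivMod
open import Data.Nat.Divisibility using (n∣m*n)
open import Data.Nat.Properties
open import Data.Product using (Σ; _×_; _,_; proj₁; ∃-syntax)
open import Data.Sum using (inj₁; inj₂)
open import Data.Vec using (Vec; []; _∷_; _++_; toList)
open import Data.Vec.Relation.Unary.All using ([]; _∷_) renaming (All to AllV)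
open import Relation.Binary.PropositionalEquality
open import Relation.Nullary using (yes; no)

-- bit i N is the i-th binary digit of N (true for 0, false for 1).
bit : ℕ → ℕ → Bool
bit zero    N = even? N
bit (suc i) N = bit i ⌊ N /2⌋

parity-half-injective : ∀ m n → even? m ≡ even? n → ⌊ m /2⌋ ≡ ⌊ n /2⌋ → m ≡ n
parity-half-injective zero          zero          _ _ = refl
parity-half-injective zero          (suc zero)    () _
parity-half-injective zero          (suc (suc n)) _ ()
parity-half-injective (suc zero)    zero          () _
parity-half-injective (suc zero)    (suc zero)    _ _ = refl
parity-half-injective (suc zero)    (suc (suc n)) _ ()
parity-half-injective (suc (suc m)) zero          _ ()
parity-half-injective (suc (suc m)) (suc zero)    _ ()
parity-half-injective (suc (suc m)) (suc (suc n)) p q =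
  cong (_+_ 2) (parity-half-injective m n p (suc-injective q))

half-< : ∀ n k → n < 2 * k → ⌊ n /2⌋ < k
half-< n k n<2k = *-cancelˡ-< 2 ⌊ n /2⌋ k (≤-<-trans twice-half≤n n<2k)
  where
  open ≤-Reasoning
  twice-half≤n : 2 * ⌊ n /2⌋ ≤ n
  twice-half≤n = begin
    2 * ⌊ n /2⌋         ≡⟨ cong (_+_ ⌊ n /2⌋) (+-identityʳ ⌊ n /2⌋) ⟩
    ⌊ n /2⌋ + ⌊ n /2⌋   ≤⟨ +-monoʳ-≤ ⌊ n /2⌋ (⌊n/2⌋≤⌈n/2⌉ n) ⟩
    ⌊ n /2⌋ + ⌈ n /2⌉   ≡⟨ ⌊n/2⌋+⌈n/2⌉≡n n ⟩
    n                   ∎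

bits-differ : ∀ K {N N'} → N < 2 ^ K → N' < 2 ^ K → N ≢ N' →
  ∃[ i ] i < K × bit i N ≢ bit i N'
bits-differ zero    (s≤s z≤n) (s≤s z≤n) N≢N' = ⊥-elim (N≢N' refl)
bits-differ (suc K) {N} {N'} N<2^K' N'<2^K' N≢N' with even? N ≟ᵇ even? N'
... | no parities≢ = 0 , z<s , parities≢
... | yes parities≡ =
  let i , i<K , bits≢ = bits-differ K (half-< N _ N<2^K') (half-< N' _ N'<2^K')
                          (λ halves≡ → N≢N' (parity-half-injective N N' parities≡ halves≡))
  in suc i , s<s i<K , bits≢

-- Filling the zeros of a colouring

fill : Color → Bool → Color
fill neg _     = neg
fill pos _     = pos
fill zer false = neg
fill zer true  = pos

fill-obtained : ∀ {r n} (col : Edge r n → Color) (choice : Edge r n → Bool) →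
  ObtainedFrom col (λ e → fill (col e) (choice e))
fill-obtained col choice e with col e | choice e
... | neg | _     = (λ ()) , λ _ → refl
... | pos | _     = (λ ()) , λ _ → refl
... | zer | false = (λ _ → inj₁ refl) , λ zer≢zer → ⊥-elim (zer≢zer refl)
... | zer | true  = (λ _ → inj₂ refl) , λ zer≢zer → ⊥-elim (zer≢zer refl)

fill-zer-injective : ∀ {a b} → fill zer a ≡ fill zer b → a ≡ b
fill-zer-injective {false} {false} _ = refl
fill-zer-injective {true}  {true}  _ = refl
fill-zer-injective {false} {true}  ()
fill-zer-injective {true}  {false} ()

fillings : ∀ {r n} (col : Edge r n → Color) (code : Edge r n → ℕ) (K : ℕ) →
  (∀ i → i < K → Σ (Edge r n) λ e → col e ≡ zer × code e ≡ i) →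
  Σ (List (Edge r n → Color)) λ L →
    All (ObtainedFrom col) L × AllPairs Distinct L × length L ≡ 2 ^ K
fillings {r} {n} col code K zeroEdge =
  applyUpTo coloring (2 ^ K) ,
  AllP.applyUpTo⁺₂ coloring (2 ^ K) (λ N → fill-obtained col (λ e → bit (code e) N)) ,
  AllPairsP.applyUpTo⁺₁ coloring (2 ^ K)
    (λ i<j j<2^K → distinct (<-trans i<j j<2^K) j<2^K (<⇒≢ i<j)) ,
  length-applyUpTo coloring (2 ^ K)
  where
  coloring : ℕ → Edge r n → Color
  coloring N e = fill (col e) (bit (code e) N)

  distinct : ∀ {N N'} → N < 2 ^ K → N' < 2 ^ K → N ≢ N' →
    Distinct (coloring N) (coloring N')
  distinct N<2^K N'<2^K N≢N' same-colours
    with bits-differ K N<2^K N'<2^K N≢N'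
  ... | i , i<K , bits≢ with zeroEdge i i<K
  ... | e , col-e≡zer , refl =
    bits≢ (fill-zer-injective (subst (λ x → fill x _ ≡ fill x _) col-e≡zer (same-colours e)))

nonneg-difference : ∀ a b {e} → + a - + b ≡ + e → e ≡ a ∸ b
nonneg-difference a b {e} a-b≡e with b ≤? a
... | yes b≤a = +-injective (trans (sym a-b≡e) (trans (m-n≡m⊖n a b) (⊖-≥ b≤a)))
... | no  b≰a = ⊥-elim (nonneg≢neg (m<n⇒0<n∸m a<b)
                  (trans (sym a-b≡e) (trans (m-n≡m⊖n a b) (⊖-< a<b))))
  where
  a<b : a < b
  a<b = ≰⇒> b≰a
  nonneg≢neg : ∀ {d} → 0 < d → + e ≢ - (+ d)
  nonneg≢neg {suc d} _ ()

atLeast-2^ : ∀ r .{{_ : NonZero r}} K a b → r ^ (a ∸ b) ≤ K →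
  AtLeast2PowPow (2 ^ K) r (+ a - + b)
atLeast-2^ r K a b r^[a∸b]≤K with + a - + b in a-b≡z
... | + e rewrite nonneg-difference a b a-b≡z = ^-monoʳ-≤ 2 r^[a∸b]≤K
... | -[1+ k ] = begin
  2                       ≤⟨ ^-monoʳ-≤ 2 (*-mono-≤ 1≤K (m^n>0 r (suc k))) ⟩
  2 ^ (K * r ^ suc k)     ≡⟨ ^-*-assoc 2 K (r ^ suc k) ⟨
  (2 ^ K) ^ (r ^ suc k)   ∎
  where
  open ≤-Reasoning
  1≤K : 1 ≤ K
  1≤K = ≤-trans (m^n>0 r (a ∸ b)) r^[a∸b]≤K

exponent-bound : ∀ r h → (r ∸ 1) * (h ∸ 1) ∸ 2 * r ≤ (h ∸ 2) * (r ∸ 1)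
exponent-bound r h = begin
  (r ∸ 1) * (h ∸ 1) ∸ 2 * r         ≤⟨ ∸-monoʳ-≤ _ r∸1≤2r ⟩
  (r ∸ 1) * (h ∸ 1) ∸ (r ∸ 1)       ≡⟨ cong ((r ∸ 1) * (h ∸ 1) ∸_) (*-identityʳ (r ∸ 1)) ⟨
  (r ∸ 1) * (h ∸ 1) ∸ (r ∸ 1) * 1   ≡⟨ *-distribˡ-∸ (r ∸ 1) (h ∸ 1) 1 ⟨
  (r ∸ 1) * (h ∸ 1 ∸ 1)             ≡⟨ cong ((r ∸ 1) *_) (∸-+-assoc h 1 1) ⟩
  (r ∸ 1) * (h ∸ 2)                 ≡⟨ *-comm (r ∸ 1) (h ∸ 2) ⟩
  (h ∸ 2) * (r ∸ 1)                 ∎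
  where
  open ≤-Reasoning
  r∸1≤2r : r ∸ 1 ≤ 2 * r
  r∸1≤2r = ≤-trans (m∸n≤m r 1) (m≤m+n r (r + 0))

elems-⊥ : ∀ n → elems (Subset.⊥ {n}) ≡ []
elems-⊥ zero    = refl
elems-⊥ (suc n) = cong (map suc) (elems-⊥ n)

elems-⁅⁆ : ∀ {n} (i : Fin n) → elems ⁅ i ⁆ ≡ suc (toℕ i) ∷ []
elems-⁅⁆ {suc n} Fin.zero    = cong (λ xs → 1 ∷ map suc xs) (elems-⊥ n)
elems-⁅⁆         (Fin.suc i) = cong (map suc) (elems-⁅⁆ i)

map-suc-shift : ∀ a (ys zs : List ℕ) →
  map suc (ys ++ˡ map (_+_ a) zs) ≡ map suc ys ++ˡ map (_+_ (suc a)) zs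
map-suc-shift a ys zs =
  trans (map-++ suc ys (map (_+_ a) zs)) (cong (map suc ys ++ˡ_) (sym (map-∘ zs)))

elems-++ : ∀ {a b} (A : Subset a) (B : Subset b) →
  elems (A ++ B) ≡ elems A ++ˡ map (_+_ a) (elems B)
elems-++          []          B = sym (map-id (elems B))
elems-++ {suc a} (true ∷ A)  B =
  cong (1 ∷_) (trans (cong (map suc) (elems-++ A B)) (map-suc-shift a (elems A) (elems B)))
elems-++ {suc a} (false ∷ A) B =
  trans (cong (map suc) (elems-++ A B)) (map-suc-shift a (elems A) (elems B))

∣++∣ : ∀ {a b} (A : Subset a) (B : Subset b) → ∣ A ++ B ∣ ≡ ∣ A ∣ + ∣ B ∣
∣++∣ []          B = refl
∣++∣ (true ∷ A)  B = cong suc (∣++∣ A B)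
∣++∣ (false ∷ A) B = ∣++∣ A B

block-quot : ∀ m .{{_ : NonZero m}} b {j} → j < m → (j + b * m) / m ≡ b
block-quot m b {j} j<m = begin
  (j + b * m) / m       ≡⟨ +-distrib-/-∣ʳ j (n∣m*n b) ⟩
  j / m + b * m / m     ≡⟨ cong₂ _+_ (m<n⇒m/n≡0 j<m) (m*n/n≡m b m) ⟩
  b                     ∎
  where open ≡-Reasoning

block-rem : ∀ m .{{_ : NonZero m}} b {j} → j < m → (j + b * m) % m ≡ j
block-rem m b j<m = trans ([m+kn]%n≡m%n _ b m) (m<n⇒m%n≡m j<m)

blockOf-elem : ∀ m .{{_ : NonZero m}} b {j} → j < m → blockOf m (suc (j + b * m)) ≡ b
blockOf-elem (suc m) b j<m = block-quot (suc m) b j<m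

b≢ᵇsuc[b] : ∀ b → (b ≡ᵇ suc b) ≡ false
b≢ᵇsuc[b] zero    = refl
b≢ᵇsuc[b] (suc b) = b≢ᵇsuc[b] b

compare3-refl : ∀ a → compare3 a a ≡ zer
compare3-refl zero    = refl
compare3-refl (suc a) = compare3-refl a

even?-suc : ∀ b → even? (suc b) ≡ not (even? b)
even?-suc zero          = refl
even?-suc (suc zero)    = refl
even?-suc (suc (suc b)) = even?-suc b

altSum : ∀ {k} → Bool → Vec ℕ k → ℕ
altSum q []       = 0
altSum q (j ∷ js) = (if q then suc j else 0) + altSum (not q) js

-- Transversal edges: one element in each of k consecutive blocks of size m

module Transversal (m : ℕ) .{{_ : NonZero m}} where

  blockElems : ∀ {k} → ℕ → Vec ℕ k → List ℕ
  blockElems b []       = []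
  blockElems b (j ∷ js) = suc (j + b * m) ∷ blockElems (suc b) js

  singletonGroups : ∀ {k} → ℕ → Vec ℕ k → List (ℕ × List ℕ)
  singletonGroups b []       = []
  singletonGroups b (j ∷ js) = (b , suc (j + b * m) ∷ []) ∷ singletonGroups (suc b) js

  insert-new-block : ∀ {k} b v (js : Vec ℕ k) →
    insertGrp b v (singletonGroups (suc b) js) ≡ (b , v ∷ []) ∷ singletonGroups (suc b) js
  insert-new-block b v []       = refl
  insert-new-block b v (j ∷ js) rewrite b≢ᵇsuc[b] b = refl

  groups-blockElems : ∀ {k} b (js : Vec ℕ k) → AllV (_< m) js →
    groups m (blockElems b js) ≡ singletonGroups b js
  groups-blockElems b []       []            = refl
  groups-blockElems b (j ∷ js) (j<m ∷ js<m)
    rewrite blockOf-elem m b j<m | groups-blockElems (suc b) js js<m =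
    insert-new-block b _ js

  allSingletons-singletonGroups : ∀ {k} b (js : Vec ℕ k) →
    allSingletons (singletonGroups b js) ≡ true
  allSingletons-singletonGroups b []       = refl
  allSingletons-singletonGroups b (j ∷ js) = allSingletons-singletonGroups (suc b) js

  sumOddI-blockElems : ∀ {k} b (js : Vec ℕ k) → AllV (_< m) js →
    sumOddI m (blockElems b js) ≡ altSum (even? b) js
  sumOddI-blockElems b []       []           = refl
  sumOddI-blockElems b (j ∷ js) (j<m ∷ js<m)
    rewrite blockOf-elem m b j<m | m+n∸n≡m (suc j) (b * m)
          | sumOddI-blockElems (suc b) js js<m | even?-suc b = refl

  sumEvenI-blockElems : ∀ {k} b (js : Vec ℕ k) → AllV (_< m) js →
    sumEvenI m (blockElems b js) ≡ altSum (not (even? b)) js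
  sumEvenI-blockElems b []       []           = refl
  sumEvenI-blockElems b (j ∷ js) (j<m ∷ js<m)
    rewrite blockOf-elem m b j<m | m+n∸n≡m (suc j) (b * m)
          | sumEvenI-blockElems (suc b) js js<m | even?-suc b
          | not-involutive (even? b) with even? b
  ... | true  = refl
  ... | false = refl

  colorStep-transversal : ∀ rec {k} (js : Vec ℕ (2 + k)) → AllV (_< m) js →
    colorStep rec m (blockElems 0 js) (groups m (blockElems 0 js))
      ≡ compare3 (altSum false js) (altSum true js)
  colorStep-transversal rec (j ∷ j' ∷ js) js<m
    rewrite groups-blockElems 0 (j ∷ j' ∷ js) js<m
          | allSingletons-singletonGroups 2 js
          | sumEvenI-blockElems 0 (j ∷ j' ∷ js) js<m
          | sumOddI-blockElems 0 (j ∷ j' ∷ js) js<m = refl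

  shift-blockElems : ∀ {k} b (js : Vec ℕ k) →
    map (_+_ m) (blockElems b js) ≡ blockElems (suc b) js
  shift-blockElems b []       = refl
  shift-blockElems b (j ∷ js) =
    cong₂ _∷_ (trans (+-suc m (j + b * m)) (cong suc (+-comm-middle j)))
              (shift-blockElems (suc b) js)
    where
    +-comm-middle : ∀ j → m + (j + b * m) ≡ j + (m + b * m)
    +-comm-middle j = trans (sym (+-assoc m j (b * m)))
                        (trans (cong (_+ b * m) (+-comm m j)) (+-assoc j m (b * m)))

  transversal : ∀ {k} (js : Vec ℕ k) → AllV (_< m) js → Subset (k * m)
  transversal []       []           = []
  transversal (j ∷ js) (j<m ∷ js<m) = ⁅ fromℕ< j<m ⁆ ++ transversal js js<m

  ∣transversal∣ : ∀ {k} (js : Vec ℕ k) (js<m : AllV (_< m) js) → ∣ transversal js js<m ∣ ≡ k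
  ∣transversal∣ []       []           = refl
  ∣transversal∣ (j ∷ js) (j<m ∷ js<m) =
    trans (∣++∣ ⁅ fromℕ< j<m ⁆ (transversal js js<m))
          (cong₂ _+_ (∣⁅x⁆∣≡1 (fromℕ< j<m)) (∣transversal∣ js js<m))

  elems-transversal : ∀ {k} (js : Vec ℕ k) (js<m : AllV (_< m) js) →
    elems (transversal js js<m) ≡ blockElems 0 js
  elems-transversal []       []           = refl
  elems-transversal (j ∷ js) (j<m ∷ js<m) = begin
    elems (⁅ fromℕ< j<m ⁆ ++ transversal js js<m)
      ≡⟨ elems-++ ⁅ fromℕ< j<m ⁆ (transversal js js<m) ⟩
    elems ⁅ fromℕ< j<m ⁆ ++ˡ map (_+_ m) (elems (transversal js js<m))
      ≡⟨ cong₂ _++ˡ_ (elems-⁅⁆ (fromℕ< j<m)) (cong (map (_+_ m)) (elems-transversal js js<m)) ⟩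
    suc (toℕ (fromℕ< j<m)) ∷ map (_+_ m) (blockElems 0 js)
      ≡⟨ cong₂ (λ x xs → suc x ∷ xs) (trans (toℕ-fromℕ< j<m) (sym (+-identityʳ j)))
               (shift-blockElems 0 js) ⟩
    blockElems 0 (j ∷ js)
      ∎
    where open ≡-Reasoning

-- Base-t digits

module Digits (t : ℕ) .{{_ : NonZero t}} where

  enc : List ℕ → ℕ
  enc []       = 0
  enc (x ∷ xs) = x + enc xs * t

  digits : (n : ℕ) → ℕ → Vec ℕ n
  digits zero    i = []
  digits (suc n) i = i % t ∷ digits n (i / t)

  digits-< : ∀ n i → AllV (_< t) (digits n i)
  digits-< zero    i = []
  digits-< (suc n) i = m%n<n i t ∷ digits-< n (i / t)

  enc-digits : ∀ n {i} → i < t ^ n → enc (toList (digits n i)) ≡ i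
  enc-digits zero    {zero}  _        = refl
  enc-digits zero    {suc i} (s≤s ())
  enc-digits (suc n) {i}     i<t^1+n  = begin
    i % t + enc (toList (digits n (i / t))) * t  ≡⟨ cong (λ q → i % t + q * t) (enc-digits n i/t<t^n) ⟩
    i % t + i / t * t                            ≡⟨ m≡m%n+[m/n]*n i t ⟨
    i                                            ∎
    where
    open ≡-Reasoning
    i/t<t^n : i / t < t ^ n
    i/t<t^n = m<n*o⇒m/o<n (subst (i <_) (*-comm t (t ^ n)) i<t^1+n)

-- Zero edges of c_{r,h} for h ≥ 2, with r = r0 + 3 and h = h' + 2

module ZeroEdges (r0 h' : ℕ) where

  r t m : ℕ
  r = 3 + r0
  t = r ^ h'
  m = r ^ suc h'

  instance
    t≢0 : NonZero t
    t≢0 = m^n≢0 r h'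
    m≢0 : NonZero m
    m≢0 = m^n≢0 r (suc h')

  open Transversal m
  open Digits t

  lift : ∀ {n} → Bool → Vec ℕ n → Vec ℕ n
  lift q []       = []
  lift q (x ∷ xs) = (if q then x else x + t) ∷ lift (not q) xs

  heavy-bound : ∀ q {n} (xs : Vec ℕ n) → AllV (_< t) xs →
    altSum (not q) (lift q xs) + (if q then t else 0) ≤ suc n * t
  heavy-bound true  []               []           = ≤-reflexive (sym (+-identityʳ t))
  heavy-bound false []               []           = z≤n
  heavy-bound true  {suc n} (x ∷ xs) (x<t ∷ xs<t) = begin
    altSum true (lift false xs) + t       ≡⟨ +-comm _ t ⟩
    t + altSum true (lift false xs)       ≡⟨ cong (_+_ t) (+-identityʳ _) ⟨
    t + (altSum true (lift false xs) + 0) ≤⟨ +-monoʳ-≤ t (heavy-bound false xs xs<t) ⟩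
    t + suc n * t                         ∎
    where open ≤-Reasoning
  heavy-bound false {suc n} (x ∷ xs) (x<t ∷ xs<t) = begin
    suc (x + t) + S + 0   ≡⟨ +-identityʳ _ ⟩
    suc x + t + S         ≡⟨ +-assoc (suc x) t S ⟩
    suc x + (t + S)       ≤⟨ +-monoˡ-≤ (t + S) x<t ⟩
    t + (t + S)           ≡⟨ cong (_+_ t) (+-comm t S) ⟩
    t + (S + t)           ≤⟨ +-monoʳ-≤ t (heavy-bound true xs xs<t) ⟩
    t + suc n * t         ∎
    where
    open ≤-Reasoning
    S : ℕ
    S = altSum false (lift true xs)

  light-bound : ∀ q {n} (xs : Vec ℕ n) → AllV (_< t) xs →
    altSum q (lift q xs) ≤ altSum (not q) (lift q xs) + (if q then t else 0)
  light<heavy : ∀ {n} x (xs : Vec ℕ n) → AllV (_< t) (x ∷ xs) →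
    altSum false (lift false (x ∷ xs)) < altSum true (lift false (x ∷ xs))

  light-bound q     []       []           = z≤n
  light-bound true  (x ∷ xs) (x<t ∷ xs<t) = begin
    suc x + altSum false (lift false xs)        ≤⟨ +-mono-≤ x<t (light-bound false xs xs<t) ⟩
    t + (altSum true (lift false xs) + 0)       ≡⟨ cong (_+_ t) (+-identityʳ _) ⟩
    t + altSum true (lift false xs)             ≡⟨ +-comm t _ ⟩
    altSum true (lift false xs) + t             ∎
    where open ≤-Reasoning
  light-bound false (x ∷ xs) xs<t =
    ≤-trans (<⇒≤ (light<heavy x xs xs<t)) (≤-reflexive (sym (+-identityʳ _)))

  light<heavy x xs (x<t ∷ xs<t) = s≤s (begin
    altSum true (lift true xs)            ≤⟨ light-bound true xs xs<t ⟩
    altSum false (lift true xs) + t       ≤⟨ m≤n+m _ x ⟩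
    x + (altSum false (lift true xs) + t) ≡⟨ cong (_+_ x) (+-comm _ t) ⟩
    x + (t + altSum false (lift true xs)) ≡⟨ +-assoc x t _ ⟨
    x + t + altSum false (lift true xs)   ∎)
    where open ≤-Reasoning

  -- The offset in block 0 balancing the alternating sums.
  balance : ∀ {n} → Vec ℕ n → ℕ
  balance xs = altSum true (lift false xs) ∸ suc (altSum false (lift false xs))

  balance-eq : ∀ {n} x (xs : Vec ℕ n) → AllV (_< t) (x ∷ xs) →
    suc (balance (x ∷ xs)) + altSum false (lift false (x ∷ xs)) ≡ altSum true (lift false (x ∷ xs))
  balance-eq x xs xs<t =
    trans (sym (+-suc (balance (x ∷ xs)) _)) (m∸n+n≡m (light<heavy x xs xs<t))

  offsets : Vec ℕ (2 + r0) → Vec ℕ r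
  offsets xs = balance xs ∷ lift false xs

  offsets-balanced : ∀ xs → AllV (_< t) xs → altSum false (offsets xs) ≡ altSum true (offsets xs)
  offsets-balanced (x ∷ xs) xs<t = sym (balance-eq x xs xs<t)

  lift-< : ∀ q {n} (xs : Vec ℕ n) → AllV (_< t) xs → AllV (_< m) (lift q xs)
  lift-< q     []       []           = []
  lift-< true  (x ∷ xs) (x<t ∷ xs<t) = <-≤-trans x<t (m≤m+n t _) ∷ lift-< false xs xs<t
  lift-< false (x ∷ xs) (x<t ∷ xs<t) =
    <-≤-trans (+-monoˡ-< t x<t) (+-monoʳ-≤ t (m≤m+n t _)) ∷ lift-< true xs xs<t

  offsets-< : ∀ xs → AllV (_< t) xs → AllV (_< m) (offsets xs)
  offsets-< (x ∷ xs) xs<t = balance<m ∷ lift-< false (x ∷ xs) xs<t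
    where
    balance<m : balance (x ∷ xs) < m
    balance<m = ≤-trans (≤-trans (m≤m+n _ _) (≤-reflexive (balance-eq x xs xs<t)))
                        (≤-trans (≤-reflexive (sym (+-identityʳ _))) (heavy-bound false (x ∷ xs) xs<t))

  -- Reading the digit back from an element of a transversal.
  digitOf : ℕ → ℕ
  digitOf v = (v ∸ 1) % m % t

  digitOf-lift : ∀ b q {n} (xs : Vec ℕ n) → AllV (_< t) xs →
    map digitOf (blockElems b (lift q xs)) ≡ toList xs
  digitOf-lift b q     []       []           = refl
  digitOf-lift b true  (x ∷ xs) (x<t ∷ xs<t) =
    cong₂ _∷_ (trans (cong (_% t) (block-rem m b (<-≤-trans x<t (m≤m+n t _)))) (m<n⇒m%n≡m x<t))
              (digitOf-lift (suc b) false xs xs<t)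
  digitOf-lift b false (x ∷ xs) (x<t ∷ xs<t) with lift-< false (x ∷ xs) (x<t ∷ xs<t)
  ... | x+t<m ∷ _ =
    cong₂ _∷_ (trans (cong (_% t) (block-rem m b x+t<m)) (trans ([m+n]%n≡m%n x t) (m<n⇒m%n≡m x<t)))
              (digitOf-lift (suc b) true xs xs<t)

  code : Edge r (r ^ suc (suc h')) → ℕ
  code e = enc (map digitOf (drop 1 (elems (proj₁ e))))

  -- The edge of colour 0 with code i: the transversal whose blocks 1, 2, …
  -- carry the base-t digits of i, balanced in block 0.
  zeroEdge : ∀ i → i < t ^ (2 + r0) →
    Σ (Edge r (r ^ suc (suc h'))) λ e → c r (suc (suc h')) e ≡ zer × code e ≡ i
  zeroEdge i i<t^[r-1] =
    (transversal js js<m , ∣transversal∣ js js<m) , colour-zero , code≡i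
    where
    xs : Vec ℕ (2 + r0)
    xs = digits (2 + r0) i
    xs<t : AllV (_< t) xs
    xs<t = digits-< (2 + r0) i
    js : Vec ℕ r
    js = offsets xs
    js<m : AllV (_< m) js
    js<m = offsets-< xs xs<t

    colour-zero : colorL r (suc (suc h')) (elems (transversal js js<m)) ≡ zer
    colour-zero = begin
      colorL r (suc (suc h')) (elems (transversal js js<m))
        ≡⟨ cong (λ vs → colorStep (colorL r (suc h')) m vs (groups m vs)) (elems-transversal js js<m) ⟩
      colorStep (colorL r (suc h')) m (blockElems 0 js) (groups m (blockElems 0 js))
        ≡⟨ colorStep-transversal (colorL r (suc h')) js js<m ⟩
      compare3 (altSum false js) (altSum true js)
        ≡⟨ cong (λ a → compare3 a (altSum true js)) (offsets-balanced xs xs<t) ⟩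
      compare3 (altSum true js) (altSum true js)
        ≡⟨ compare3-refl (altSum true js) ⟩
      zer
        ∎
      where open ≡-Reasoning

    code≡i : enc (map digitOf (drop 1 (elems (transversal js js<m)))) ≡ i
    code≡i = begin
      enc (map digitOf (drop 1 (elems (transversal js js<m))))
        ≡⟨ cong (λ vs → enc (map digitOf (drop 1 vs))) (elems-transversal js js<m) ⟩
      enc (map digitOf (blockElems 1 (lift false xs)))
        ≡⟨ cong enc (digitOf-lift 1 false xs xs<t) ⟩
      enc (toList xs)
        ≡⟨ enc-digits (2 + r0) i<t^[r-1] ⟩
      i
        ∎
      where open ≡-Reasoning

zeroEdges : ∀ r h → 3 ≤ r → 1 ≤ h →
  Σ (Edge r (r ^ h) → ℕ) λ code → ∀ i → i < (r ^ (h ∸ 2)) ^ (r ∸ 1) →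
    Σ (Edge r (r ^ h)) λ e → c r h e ≡ zer × code e ≡ i
zeroEdges r@(suc (suc (suc r0))) (suc zero) (s≤s (s≤s (s≤s _))) (s≤s _) =
  (λ _ → 0) , λ i i<1 → (⊤ , trans (∣⊤∣≡n (r * 1)) (*-identityʳ r)) , refl ,
                        sym (n<1⇒n≡0 (subst (i <_) (^-zeroˡ (r ∸ 1)) i<1))
zeroEdges (suc (suc (suc r0))) (suc (suc h')) (s≤s (s≤s (s≤s _))) (s≤s _) = code , zeroEdge
  where open ZeroEdges r0 h'

lemma4p2 : (r h : ℕ) → 3 ≤ r → 1 ≤ h →
    Σ (List (Edge r (r Data.Nat.^ h) → Color)) (λ L →
      All (ObtainedFrom (c r h)) L × AllPairs Distinct L ×
      AtLeast2PowPow (length L) r (+ ((r ∸ 1) * (h ∸ 1)) - + (2 * r)))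
lemma4p2 r h 3≤r 1≤h =
  let code , zero-edges = zeroEdges r h 3≤r 1≤h
      L , obtained , distinct , |L|≡2^K = fillings (c r h) code K zero-edges
  in  L , obtained , distinct ,
      subst (λ N → AtLeast2PowPow N r _) (sym |L|≡2^K)
            (atLeast-2^ r K ((r ∸ 1) * (h ∸ 1)) (2 * r) r^exponent≤K)
  where
  instance
    r≢0 : NonZero r
    r≢0 = >-nonZero (≤-trans (s≤s z≤n) 3≤r)

  K : ℕ
  K = (r ^ (h ∸ 2)) ^ (r ∸ 1)

  r^exponent≤K : r ^ ((r ∸ 1) * (h ∸ 1) ∸ 2 * r) ≤ K
  r^exponent≤K = begin
    r ^ ((r ∸ 1) * (h ∸ 1) ∸ 2 * r)  ≤⟨ ^-monoʳ-≤ r (exponent-bound r h) ⟩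
    r ^ ((h ∸ 2) * (r ∸ 1))          ≡⟨ ^-*-assoc r (h ∸ 2) (r ∸ 1) ⟨
    K                                ∎
    where open ≤-Reasoning
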